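{- Let $p$ be an odd prime and let $u,v$ be integers with $u^2\equiv 3\pmod p$ and $v\equiv 1\pmod p$. Then the sequences $(\alpha_i)_{i\ge1}$, $(\beta_i)_{i\ge 1}$ defined below satisfy, for all $k\ge 0$: $\alpha_{3k+1}\equiv -u$, $\alpha_{3k+2}+\alpha_{3k+3}\equiv u\pmod p$; $\alpha_{9k+2}\equiv u$, $\alpha_{9k+5}\equiv\alpha_{3k+3}$, $\alpha_{9k+8}\equiv 0\pmod p$; $\beta_1\equiv 1$, $\beta_2\equiv 2$, $\beta_{k+3}\equiv 1\pmod p$.
   Context: Given $u,v$, define rational numbers $\alpha_i,\beta_i$ ($i\ge 1$) by $\alpha_1=-u$, $\alpha_2=\frac{u(2v-1-u^2)}{v-u^2}$, $\alpha_3=\frac{ -u(v-1)}{v-u^2}$, $\beta_1=1$, $\beta_2=u^2-v$, $\beta_3=\frac{u^2+u^4+v^3-3u^2v}{(v-u^2)^2}$, and for every $k\ge 0$: $\alpha_{3k+4}=-u$, $\beta_{3k+4}=\frac{\beta_{k+2}}{\beta_{3k+3}\beta_{3k+2}}$, $\beta_{3k+5}=u^2-v-\beta_{3k+4}$, $\alpha_{3k+5}=u-\frac{\alpha_{k+2}+uv-\alpha_{3k+2}\beta_{3k+4}}{\beta_{3k+5}}$, $\alpha_{3k+6}=u-\alpha_{3k+5}$, $\beta_{3k+6}=v-\alpha_{3k+5}\alpha_{3k+6}$. Congruences modulo $p$ between rational numbers are understood in the local ring $\mathbb{Z}_{(p)}$ of rationals with denominator prime to $p$; asserting such a congruence for $\alpha_i$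 or $\beta_i$ includes that it is well defined (no division by zero) and lies in $\mathbb{Z}_{(p)}$. -}

module Defs where

open import Data.Nat as ℕ using (ℕ; zero; suc)
open import Data.Nat.Divisibility using (_∣_)
open import Data.Integer as ℤ using (ℤ)
open import Data.Rational as ℚ using (ℚ; 0ℚ; ↥_; ↧ₙ_)
open import Data.Rational.Properties as ℚP using ()
open import Data.Maybe using (Maybe; just; nothing)
open import Data.Product using (_×_; _,_; Σ-syntax)
open import Relation.Nullary using (¬_; yes; no)
open import Relation.Binary.PropositionalEquality using (_≡_)

-- Partial arithmetic on rationals: `nothing` records that some division by
-- zero occurred somewhere in the computation.
M : Set
M = Maybe ℚ

infixl 6 _⊕_ _⊖_
infixl 7 _⊗_ _⊘_

_⊕_ : M → M → M
just x ⊕ just y = just (x ℚ.+ y)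
_ ⊕ _ = nothing

_⊖_ : M → M → M
just x ⊖ just y = just (x ℚ.- y)
_ ⊖ _ = nothing

_⊗_ : M → M → M
just x ⊗ just y = just (x ℚ.* y)
_ ⊗ _ = nothing

_⊘_ : M → M → M
just x ⊘ just y with y ℚP.≟ 0ℚ
... | yes _ = nothing
... | no y≢0 = just (ℚ._÷_ x y {{ℚ.≢-nonZero y≢0}})
_ ⊘ _ = nothing

ι : ℤ → M
ι i = just (i ℚ./ 1)

-- One step of the recurrence: given the table f of (α_i , β_i) that is
-- correct for indices 1 … 3k+3, add indices 3k+4, 3k+5, 3k+6.
-- (Indices are 1-based; index 0 is unused and holds (nothing , nothing).)
module _ (u v : ℤ) where

  U V : M
  U = ι u
  V = ι v

  initial : ℕ → M × M
  initial 1 = (ι (ℤ.- u) , ι (ℤ.+ 1))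
  initial 2 = ( (U ⊗ (ι (ℤ.+ 2) ⊗ V ⊖ ι (ℤ.+ 1) ⊖ U ⊗ U)) ⊘ (V ⊖ U ⊗ U)
              , U ⊗ U ⊖ V )
  initial 3 = ( (ι (ℤ.- u) ⊗ (V ⊖ ι (ℤ.+ 1))) ⊘ (V ⊖ U ⊗ U)
              , (U ⊗ U ⊕ U ⊗ U ⊗ U ⊗ U ⊕ V ⊗ V ⊗ V ⊖ ι (ℤ.+ 3) ⊗ U ⊗ U ⊗ V)
                  ⊘ ((V ⊖ U ⊗ U) ⊗ (V ⊖ U ⊗ U)) )
  initial _ = (nothing , nothing)

  α[_] β[_] : (ℕ → M × M) → ℕ → M
  α[ f ] i = Data.Product.proj₁ (f i)
  β[ f ] i = Data.Product.proj₂ (f i)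

  b4[_,_] a5[_,_] b5[_,_] a6[_,_] b6[_,_] : (ℕ → M × M) → ℕ → M
  b4[ f , k ] = β[ f ] (k ℕ.+ 2) ⊘ (β[ f ] (3 ℕ.* k ℕ.+ 3) ⊗ β[ f ] (3 ℕ.* k ℕ.+ 2))
  b5[ f , k ] = U ⊗ U ⊖ V ⊖ b4[ f , k ]
  a5[ f , k ] = U ⊖ (α[ f ] (k ℕ.+ 2) ⊕ U ⊗ V ⊖ α[ f ] (3 ℕ.* k ℕ.+ 2) ⊗ b4[ f , k ]) ⊘ b5[ f , k ]
  a6[ f , k ] = U ⊖ a5[ f , k ]
  b6[ f , k ] = V ⊖ a5[ f , k ] ⊗ a6[ f , k ]

  extend : (ℕ → M × M) → ℕ → (ℕ → M × M)
  extend f k i with i ℕ.≟ 3 ℕ.* k ℕ.+ 4 | i ℕ.≟ 3 ℕ.* k ℕ.+ 5 | i ℕ.≟ 3 ℕ.* k ℕ.+ 6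
  ... | yes _ | _ | _ = (ι (ℤ.- u) , b4[ f , k ])
  ... | no _ | yes _ | _ = (a5[ f , k ] , b5[ f , k ])
  ... | no _ | no _ | yes _ = (a6[ f , k ] , b6[ f , k ])
  ... | no _ | no _ | no _ = f i

  table : ℕ → (ℕ → M × M)
  table zero = initial
  table (suc k) = extend (table k) k

  α β : ℕ → M
  α i = α[ table i ] i
  β i = β[ table i ] i

InZp : ℕ → ℚ → Set
InZp p q = ¬ (p ∣ ↧ₙ q)

infix 4 _≡_[modℚ_]
_≡_[modℚ_] : M → M → ℕ → Set
x ≡ y [modℚ p ] = Σ[ q ∈ ℚ ] Σ[ r ∈ ℚ ]
  (x ≡ just q × y ≡ just r × InZp p q × InZp p r × (p ∣ ℤ.∣ ↥ (q ℚ.- r) ∣))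

-- Reduction modulo p is a ring homomorphism from ℤ₍ₚ₎ onto 𝔽ₚ, so as long as every
-- divisor is a unit modulo p, the residues of α_i and β_i are obtained by running the
-- recurrence in 𝔽ₚ with u² = 3 and v = 1.  By strong induction on k:
-- α_{3k+1} ≡ -u, β_{3k+1} ≡ β_{3k+3} ≡ 1, β_{3k+2} ≡ 1 (≡ 2 for k = 0), and
-- (α_{3k+2}, α_{3k+3}) ≡ (u, 0) or (0, u).  In the step, β_{k+2} ≡ β_{3k+2} gives
-- β_{3k+4} ≡ 1, then β_{3k+5} ≡ 3 - 1 - 1 = 1 and α_{3k+5} ≡ α_{3k+2} - α_{k+2}, and
-- β_{3k+6} ≡ 1 since one of α_{3k+5}, α_{3k+6} vanishes.  As α_{k+2} lies in block
-- ⌊k/3⌋ or ⌊k/3⌋ + 1, which of u and 0 is α_{3k+5} depends on k mod 3; the induction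
-- carries the resulting pattern α_{9j+2} ≡ u, α_{9j+5} ≡ α_{3j+3}, α_{9j+8} ≡ 0.
module Submission where

open import Defs
open import Data.Nat using (ℕ; _+_; _*_)
open import Relation.Binary.PropositionalEquality using (_≢_)
open import Data.Nat.Primality using (Prime)
open import Data.Integer as ℤ using (ℤ)
open import Data.Integer.Divisibility using ()
open import Data.Product using (_×_)

open import Data.Bool using (Bool; true; false; not)
open import Data.Integer using (+_; -[1+_]; +[1+_]; -_; 0ℤ; 1ℤ)
open import Data.Integer.Divisibility.Signed
  using (_∣_; divides; ∣ᵤ⇒∣; ∣⇒∣ᵤ; ∣m∣n⇒∣m+n; ∣m⇒∣-m; ∣n⇒∣m*n; ∣m⇒∣m*n)
import Data.Integer.Properties as ℤ
open import Algebra.Properties.CommutativeSemigroup ℤ.*-commutativeSemigroup using (xy∙z≈xz∙y)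
open import Data.Integer.Tactic.RingSolver using (solve)
open import Data.List using ([]; _∷_)
open import Data.Maybe using (just)
open import Data.Fin using (Fin; zero; suc)
open import Data.Nat as ℕ using (zero; suc; _≤_; _≰_; _≟_; _∸_; s≤s)
open import Data.Nat.Induction using (<-rec)
import Data.Nat.Divisibility as ℕ
import Data.Nat.Properties as ℕ
import Data.Nat.Tactic.RingSolver as ℕ-Solver
open import Data.Nat.Coprimality using (recompute)
open import Data.Nat.Primality using (euclidsLemma; prime⇒nonTrivial)
open import Data.Product using (_,_; proj₁; proj₂)
open import Data.Rational as ℚ using (ℚ; mkℚ; toℚᵘ; 0ℚ)
import Data.Rational.Properties as ℚ
open import Data.Rational.Unnormalised as ℚᵘ using (ℚᵘ; mkℚᵘ; _≃_; *≡*)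
import Data.Rational.Unnormalised.Properties as ℚᵘ
open import Data.Sum using (_⊎_; inj₁; inj₂)
open import Relation.Binary using (Setoid)
open import Relation.Binary.PropositionalEquality using (_≡_; refl; sym; trans; cong; cong₂; subst)
open import Relation.Nullary using (¬_; contradiction; yes; no)

-- Congruences modulo a prime and residues of rationals

module Reduction (p : ℕ) (p-prime : Prime p) where

  -- A record rather than a plain definition, so that a and b can be inferred.
  infix 4 _≈_
  record _≈_ (a b : ℤ) : Set where
    constructor p∣-
    field p∣difference : + p ∣ a ℤ.- b

  IsUnit : ℤ → Set
  IsUnit a = ¬ (+ p ∣ a)

  ≡⇒≈ : ∀ {a b} → a ≡ b → a ≈ b
  ≡⇒≈ {a} refl = p∣- (divides 0ℤ (ℤ.+-inverseʳ a))

  ≈-refl : ∀ {a} → a ≈ a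
  ≈-refl = ≡⇒≈ refl

  ≈-sym : ∀ {a b} → a ≈ b → b ≈ a
  ≈-sym {a} {b} (p∣- h) = p∣- (subst (+ p ∣_) {x = - (a ℤ.- b)} (solve (a ∷ b ∷ [])) (∣m⇒∣-m h))

  ≈-trans : ∀ {a b c} → a ≈ b → b ≈ c → a ≈ c
  ≈-trans {a} {b} {c} (p∣- h) (p∣- h′) =
    p∣- (subst (+ p ∣_) {x = (a ℤ.- b) ℤ.+ (b ℤ.- c)} (solve (a ∷ b ∷ c ∷ [])) (∣m∣n⇒∣m+n h h′))

  ≈-setoid : Setoid _ _
  ≈-setoid = record
    { Carrier       = ℤ
    ; _≈_           = _≈_
    ; isEquivalence = record { refl = ≈-refl ; sym = ≈-sym ; trans = ≈-trans }
    }

  +-cong : ∀ {a a′ b b′} → a ≈ a′ → b ≈ b′ → a ℤ.+ b ≈ a′ ℤ.+ b′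
  +-cong {a} {a′} {b} {b′} (p∣- h) (p∣- h′) =
    p∣- (subst (+ p ∣_) {x = (a ℤ.- a′) ℤ.+ (b ℤ.- b′)} (solve (a ∷ a′ ∷ b ∷ b′ ∷ []))
                (∣m∣n⇒∣m+n h h′))

  neg-cong : ∀ {a a′} → a ≈ a′ → - a ≈ - a′
  neg-cong {a} {a′} (p∣- h) = p∣- (subst (+ p ∣_) {x = - (a ℤ.- a′)} (solve (a ∷ a′ ∷ [])) (∣m⇒∣-m h))

  *-cong : ∀ {a a′ b b′} → a ≈ a′ → b ≈ b′ → a ℤ.* b ≈ a′ ℤ.* b′
  *-cong {a} {a′} {b} {b′} (p∣- h) (p∣- h′) =
    p∣- (subst (+ p ∣_) {x = (a ℤ.- a′) ℤ.* b ℤ.+ a′ ℤ.* (b ℤ.- b′)} (solve (a ∷ a′ ∷ b ∷ b′ ∷ []))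
                (∣m∣n⇒∣m+n (∣m⇒∣m*n b h) (∣n⇒∣m*n a′ h′)))

  open import Relation.Binary.Reasoning.Setoid ≈-setoid

  p≢1 : p ≢ 1
  p≢1 = ℕ.nonTrivial⇒≢1 {{prime⇒nonTrivial p-prime}}

  1-isUnit : IsUnit 1ℤ
  1-isUnit p∣1 = p≢1 (ℕ.∣1⇒≡1 (∣⇒∣ᵤ p∣1))

  -‿isUnit : ∀ {a} → IsUnit a → IsUnit (- a)
  -‿isUnit {a} a-unit p∣-a = a-unit (subst (+ p ∣_) (ℤ.neg-involutive a) (∣m⇒∣-m p∣-a))

  p∣ab⇒p∣a⊎p∣b : ∀ {a b} → + p ∣ a ℤ.* b → + p ∣ a ⊎ + p ∣ b
  p∣ab⇒p∣a⊎p∣b {a} {b} p∣ab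
    with euclidsLemma ℤ.∣ a ∣ ℤ.∣ b ∣ p-prime (subst (p ℕ.∣_) (ℤ.abs-* a b) (∣⇒∣ᵤ p∣ab))
  ... | inj₁ p∣a = inj₁ (∣ᵤ⇒∣ p∣a)
  ... | inj₂ p∣b = inj₂ (∣ᵤ⇒∣ p∣b)

  *-isUnit : ∀ {a b} → IsUnit a → IsUnit b → IsUnit (a ℤ.* b)
  *-isUnit a-unit b-unit p∣ab with p∣ab⇒p∣a⊎p∣b p∣ab
  ... | inj₁ p∣a = a-unit p∣a
  ... | inj₂ p∣b = b-unit p∣b

  isUnit-resp-≈ : ∀ {a b} → a ≈ b → IsUnit a → IsUnit b
  isUnit-resp-≈ {a} {b} (p∣- p∣a-b) a-unit p∣b =
    a-unit (subst (+ p ∣_) {x = (a ℤ.- b) ℤ.+ b} (solve (a ∷ b ∷ [])) (∣m∣n⇒∣m+n p∣a-b p∣b))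

  *-cancelʳ-≈ : ∀ {a b c} → IsUnit c → a ℤ.* c ≈ b ℤ.* c → a ≈ b
  *-cancelʳ-≈ {a} {b} {c} c-unit (p∣- p∣ac-bc)
    with p∣ab⇒p∣a⊎p∣b {a ℤ.- b} {c}
           (subst (+ p ∣_) {x = a ℤ.* c ℤ.- b ℤ.* c} (solve (a ∷ b ∷ c ∷ [])) p∣ac-bc)
  ... | inj₁ p∣a-b = p∣- p∣a-b
  ... | inj₂ p∣c = contradiction p∣c c-unit

  *-congˡ : ∀ a {b b′} → b ≈ b′ → a ℤ.* b ≈ a ℤ.* b′
  *-congˡ a = *-cong (≈-refl {a})

  *-congʳ : ∀ b {a a′} → a ≈ a′ → a ℤ.* b ≈ a′ ℤ.* b
  *-congʳ b a≈a′ = *-cong a≈a′ (≈-refl {b})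

  fraction-+ : ∀ {n₁ n₂} a b d₁ d₂ → n₁ ≈ a ℤ.* d₁ → n₂ ≈ b ℤ.* d₂ →
               n₁ ℤ.* d₂ ℤ.+ n₂ ℤ.* d₁ ≈ (a ℤ.+ b) ℤ.* (d₁ ℤ.* d₂)
  fraction-+ {n₁} {n₂} a b d₁ d₂ h₁ h₂ = begin
    n₁ ℤ.* d₂ ℤ.+ n₂ ℤ.* d₁              ≈⟨ +-cong (*-congʳ d₂ h₁) (*-congʳ d₁ h₂) ⟩
    a ℤ.* d₁ ℤ.* d₂ ℤ.+ b ℤ.* d₂ ℤ.* d₁  ≡⟨ solve (d₁ ∷ d₂ ∷ a ∷ b ∷ []) ⟩
    (a ℤ.+ b) ℤ.* (d₁ ℤ.* d₂)            ∎

  fraction-* : ∀ {n₁ n₂} a b d₁ d₂ → n₁ ≈ a ℤ.* d₁ → n₂ ≈ b ℤ.* d₂ →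
               n₁ ℤ.* n₂ ≈ (a ℤ.* b) ℤ.* (d₁ ℤ.* d₂)
  fraction-* {n₁} {n₂} a b d₁ d₂ h₁ h₂ = begin
    n₁ ℤ.* n₂                  ≈⟨ *-cong h₁ h₂ ⟩
    a ℤ.* d₁ ℤ.* (b ℤ.* d₂)    ≡⟨ solve (d₁ ∷ d₂ ∷ a ∷ b ∷ []) ⟩
    (a ℤ.* b) ℤ.* (d₁ ℤ.* d₂)  ∎

  fraction-÷ : ∀ {n₁ n₂} a b c d₁ d₂ → n₁ ≈ a ℤ.* d₁ → n₂ ≈ b ℤ.* d₂ → a ≈ b ℤ.* c →
               n₁ ℤ.* d₂ ≈ c ℤ.* (d₁ ℤ.* n₂)
  fraction-÷ {n₁} {n₂} a b c d₁ d₂ h₁ h₂ a≈bc = begin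
    n₁ ℤ.* d₂                  ≈⟨ *-congʳ d₂ h₁ ⟩
    a ℤ.* d₁ ℤ.* d₂            ≈⟨ *-congʳ d₂ (*-congʳ d₁ a≈bc) ⟩
    b ℤ.* c ℤ.* d₁ ℤ.* d₂      ≡⟨ solve (d₁ ∷ d₂ ∷ b ∷ c ∷ []) ⟩
    c ℤ.* (d₁ ℤ.* (b ℤ.* d₂))  ≈⟨ *-congˡ c (*-congˡ d₁ (≈-sym h₂)) ⟩
    c ℤ.* (d₁ ℤ.* n₂)          ∎

  -- Depends on the representative x (p/p ≃ 1/1), hence the hypothesis of ↦ᵘ-resp-≃.
  infix 4 _↦ᵘ_
  record _↦ᵘ_ (x : ℚᵘ) (a : ℤ) : Set where
    constructor reducesᵘ
    field
      denominator-isUnit : IsUnit (ℚᵘ.↧ x)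
      numerator-≈ : ℚᵘ.↥ x ≈ a ℤ.* ℚᵘ.↧ x

  ↦ᵘ-+ : ∀ {x y a b} → x ↦ᵘ a → y ↦ᵘ b → x ℚᵘ.+ y ↦ᵘ a ℤ.+ b
  ↦ᵘ-+ {x@(mkℚᵘ _ _)} {y@(mkℚᵘ _ _)} {a} {b} (reducesᵘ dx nx) (reducesᵘ dy ny) =
    reducesᵘ (*-isUnit dx dy) (fraction-+ a b (ℚᵘ.↧ x) (ℚᵘ.↧ y) nx ny)

  ↦ᵘ-* : ∀ {x y a b} → x ↦ᵘ a → y ↦ᵘ b → x ℚᵘ.* y ↦ᵘ a ℤ.* b
  ↦ᵘ-* {x@(mkℚᵘ _ _)} {y@(mkℚᵘ _ _)} {a} {b} (reducesᵘ dx nx) (reducesᵘ dy ny) =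
    reducesᵘ (*-isUnit dx dy) (fraction-* a b (ℚᵘ.↧ x) (ℚᵘ.↧ y) nx ny)

  ↦ᵘ-neg : ∀ {x a} → x ↦ᵘ a → ℚᵘ.- x ↦ᵘ - a
  ↦ᵘ-neg {x@(mkℚᵘ _ _)} {a} (reducesᵘ dx nx) =
    reducesᵘ dx (≈-trans (neg-cong nx) (≡⇒≈ (ℤ.neg-distribˡ-* a (ℚᵘ.↧ x))))

  ↦ᵘ-*-1/ : ∀ {x y a b c} .{{_ : ℚᵘ.NonZero y}} → x ↦ᵘ a → y ↦ᵘ b → IsUnit b → a ≈ b ℤ.* c →
            x ℚᵘ.* ℚᵘ.1/ y ↦ᵘ c
  ↦ᵘ-*-1/ {x@(mkℚᵘ _ _)} {y@(mkℚᵘ +[1+ _ ] _)} {a} {b} {c}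
          (reducesᵘ dx nx) (reducesᵘ dy ny) b-unit a≈bc =
    reducesᵘ (*-isUnit dx (isUnit-resp-≈ (≈-sym ny) (*-isUnit b-unit dy)))
             (fraction-÷ a b c (ℚᵘ.↧ x) (ℚᵘ.↧ y) nx ny a≈bc)
  ↦ᵘ-*-1/ {x@(mkℚᵘ _ _)} {y@(mkℚᵘ -[1+ _ ] _)} {a} {b} {c}
          (reducesᵘ dx nx) (reducesᵘ dy ny) b-unit a≈bc =
    reducesᵘ (*-isUnit dx (-‿isUnit (isUnit-resp-≈ (≈-sym ny) (*-isUnit b-unit dy))))
             (fraction-÷ a b c (ℚᵘ.↧ x) (- ℚᵘ.↧ y) nx
               (≈-trans (neg-cong ny) (≡⇒≈ (ℤ.neg-distribʳ-* b (ℚᵘ.↧ y)))) a≈bc)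

  ↦ᵘ-≈ : ∀ {x a b} → x ↦ᵘ a → a ≈ b → x ↦ᵘ b
  ↦ᵘ-≈ {x} (reducesᵘ dx nx) a≈b = reducesᵘ dx (≈-trans nx (*-congʳ (ℚᵘ.↧ x) a≈b))

  ↦ᵘ-resp-≃ : ∀ {x y a} → x ≃ y → IsUnit (ℚᵘ.↧ y) → x ↦ᵘ a → y ↦ᵘ a
  ↦ᵘ-resp-≃ {x} {y} {a} (*≡* eq) dy (reducesᵘ dx nx) = reducesᵘ dy (*-cancelʳ-≈ dx (begin
    ℚᵘ.↥ y ℤ.* ℚᵘ.↧ x        ≡⟨ sym eq ⟩
    ℚᵘ.↥ x ℤ.* ℚᵘ.↧ y        ≈⟨ *-congʳ (ℚᵘ.↧ y) nx ⟩
    a ℤ.* ℚᵘ.↧ x ℤ.* ℚᵘ.↧ y  ≡⟨ xy∙z≈xz∙y a (ℚᵘ.↧ x) (ℚᵘ.↧ y) ⟩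
    a ℤ.* ℚᵘ.↧ y ℤ.* ℚᵘ.↧ x  ∎))

  infix 4 _↦ℚ_
  _↦ℚ_ : ℚ → ℤ → Set
  q ↦ℚ a = toℚᵘ q ↦ᵘ a

  -- p cannot divide both the numerator and the denominator of a normalised rational.
  reduced-↧-isUnit : ∀ {q x a} → toℚᵘ q ≃ x → x ↦ᵘ a → IsUnit (ℚᵘ.↧ (toℚᵘ q))
  reduced-↧-isUnit {mkℚ n d coprime} {x} (*≡* eq) (reducesᵘ dx _) p∣d =
    p≢1 (recompute coprime (∣⇒∣ᵤ p∣n , ∣⇒∣ᵤ p∣d))
    where
    p∣n : + p ∣ n
    p∣n with p∣ab⇒p∣a⊎p∣b {n} {ℚᵘ.↧ x} (subst (+ p ∣_) (sym eq) (∣n⇒∣m*n (ℚᵘ.↥ x) p∣d))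
    ... | inj₁ p∣n = p∣n
    ... | inj₂ p∣↧x = contradiction p∣↧x dx

  ↦ℚ-via : ∀ {q x a} → toℚᵘ q ≃ x → x ↦ᵘ a → q ↦ℚ a
  ↦ℚ-via q≃x x↦a = ↦ᵘ-resp-≃ (ℚᵘ.≃-sym q≃x) (reduced-↧-isUnit q≃x x↦a) x↦a

  ↦ℚ-/1 : ∀ a → a ℚ./ 1 ↦ℚ a
  ↦ℚ-/1 a = ↦ℚ-via (ℚ.toℚᵘ-fromℚᵘ (mkℚᵘ a 0))
                   (reducesᵘ 1-isUnit (≡⇒≈ (sym (ℤ.*-identityʳ a))))

  ↦ℚ-+ : ∀ {q r a b} → q ↦ℚ a → r ↦ℚ b → q ℚ.+ r ↦ℚ a ℤ.+ b
  ↦ℚ-+ {q} {r} q↦a r↦b = ↦ℚ-via (ℚ.toℚᵘ-homo-+ q r) (↦ᵘ-+ q↦a r↦b)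

  ↦ℚ-* : ∀ {q r a b} → q ↦ℚ a → r ↦ℚ b → q ℚ.* r ↦ℚ a ℤ.* b
  ↦ℚ-* {q} {r} q↦a r↦b = ↦ℚ-via (ℚ.toℚᵘ-homo-* q r) (↦ᵘ-* q↦a r↦b)

  ↦ℚ-- : ∀ {q r a b} → q ↦ℚ a → r ↦ℚ b → q ℚ.- r ↦ℚ a ℤ.- b
  ↦ℚ-- {r = r} q↦a r↦b = ↦ℚ-+ q↦a (↦ℚ-via (ℚ.toℚᵘ-homo‿- r) (↦ᵘ-neg r↦b))

  ↦ℚ-÷ : ∀ {q r a b c} .{{_ : ℚ.NonZero r}} → q ↦ℚ a → r ↦ℚ b → IsUnit b → a ≈ b ℤ.* c →
         q ℚ.÷ r ↦ℚ c
  ↦ℚ-÷ {q} {r} q↦a r↦b b-unit a≈bc =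
    ↦ℚ-via (ℚᵘ.≃-trans (ℚ.toℚᵘ-homo-* q (ℚ.1/ r)) (ℚᵘ.*-congˡ {toℚᵘ q} (ℚ.toℚᵘ-homo-1/ r)))
           (↦ᵘ-*-1/ q↦a r↦b b-unit a≈bc)

  ↦ℚ-≢0 : ∀ {r b} → r ↦ℚ b → IsUnit b → r ≢ 0ℚ
  ↦ℚ-≢0 (reducesᵘ _ n≈b) b-unit refl =
    isUnit-resp-≈ (≈-sym n≈b) (*-isUnit b-unit 1-isUnit) (divides 0ℤ refl)

  infix 4 _↦_
  record _↦_ (x : M) (a : ℤ) : Set where
    constructor reduces
    field
      {value} : ℚ
      defined : x ≡ just value
      value-↦ : value ↦ℚ a

  ↦-ι : ∀ a → ι a ↦ a
  ↦-ι a = reduces refl (↦ℚ-/1 a)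

  ↦-≈ : ∀ {x a b} → x ↦ a → a ≈ b → x ↦ b
  ↦-≈ (reduces x≡q q↦a) a≈b = reduces x≡q (↦ᵘ-≈ q↦a a≈b)

  ↦-⊕ : ∀ {x y a b} → x ↦ a → y ↦ b → x ⊕ y ↦ a ℤ.+ b
  ↦-⊕ (reduces refl q↦a) (reduces refl r↦b) = reduces refl (↦ℚ-+ q↦a r↦b)

  ↦-⊖ : ∀ {x y a b} → x ↦ a → y ↦ b → x ⊖ y ↦ a ℤ.- b
  ↦-⊖ (reduces refl q↦a) (reduces refl r↦b) = reduces refl (↦ℚ-- q↦a r↦b)

  ↦-⊗ : ∀ {x y a b} → x ↦ a → y ↦ b → x ⊗ y ↦ a ℤ.* b
  ↦-⊗ (reduces refl q↦a) (reduces refl r↦b) = reduces refl (↦ℚ-* q↦a r↦b)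

  ↦-⊘ : ∀ {x y a b c} → x ↦ a → y ↦ b → IsUnit b → a ≈ b ℤ.* c → x ⊘ y ↦ c
  ↦-⊘ (reduces refl q↦a) (reduces {r} refl r↦b) b-unit a≈bc with r ℚ.≟ 0ℚ
  ... | yes r≡0 = contradiction r≡0 (↦ℚ-≢0 r↦b b-unit)
  ... | no r≢0 = reduces refl (↦ℚ-÷ {{ℚ.≢-nonZero r≢0}} q↦a r↦b b-unit a≈bc)

  ↦⇒≡[modℚ] : ∀ {x y a} → x ↦ a → y ↦ a → x ≡ y [modℚ p ]
  ↦⇒≡[modℚ] {a = a} (reduces {q} refl q↦a) (reduces {r} refl r↦a) =
    q , r , refl , refl , denominator-prime q↦a , denominator-prime r↦a , ∣⇒∣ᵤ p∣↥[q-r]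
    where
    denominator-prime : ∀ {s b} → s ↦ℚ b → InZp p s
    denominator-prime {mkℚ _ _ _} (reducesᵘ ds _) p∣↧s = ds (∣ᵤ⇒∣ p∣↧s)
    numerator-prime : ∀ {s} → s ↦ℚ 0ℤ → + p ∣ ℚ.↥ s
    numerator-prime {mkℚ _ _ _} (reducesᵘ _ (p∣- p∣↥-0)) = subst (+ p ∣_) (ℤ.+-identityʳ _) p∣↥-0
    p∣↥[q-r] : + p ∣ ℚ.↥ (q ℚ.- r)
    p∣↥[q-r] = numerator-prime (↦ᵘ-≈ (↦ℚ-- q↦a r↦a) (≡⇒≈ (ℤ.+-inverseʳ a)))

-- Unfolding the recurrence

3k+4≡3[k+1]+1 : ∀ k → 3 * k + 4 ≡ 3 * suc k + 1
3k+4≡3[k+1]+1 = ℕ-Solver.solve-∀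

3k+5≡3[k+1]+2 : ∀ k → 3 * k + 5 ≡ 3 * suc k + 2
3k+5≡3[k+1]+2 = ℕ-Solver.solve-∀

3k+6≡3[k+1]+3 : ∀ k → 3 * k + 6 ≡ 3 * suc k + 3
3k+6≡3[k+1]+3 = ℕ-Solver.solve-∀

module Recurrence (u v : ℤ) where

  private
    3k+m≰3k+3 : ∀ k {m} → 3 ℕ.< m → 3 * k + m ≰ 3 * k + 3
    3k+m≰3k+3 k 3<m le = ℕ.<⇒≱ 3<m (ℕ.+-cancelˡ-≤ (3 * k) _ _ le)

  table-suc : ∀ k {i} → i ≤ 3 * k + 3 → table u v (suc k) i ≡ table u v k i
  table-suc k {i} i≤ with i ≟ 3 * k + 4 | i ≟ 3 * k + 5 | i ≟ 3 * k + 6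
  ... | yes refl | _      | _      = contradiction i≤ (3k+m≰3k+3 k (ℕ.<ᵇ⇒< 3 4 _))
  ... | no _     | yes refl | _    = contradiction i≤ (3k+m≰3k+3 k (ℕ.<ᵇ⇒< 3 5 _))
  ... | no _     | no _   | yes refl = contradiction i≤ (3k+m≰3k+3 k (ℕ.<ᵇ⇒< 3 6 _))
  ... | no _     | no _   | no _   = refl

  table-+ : ∀ m {k i} → i ≤ 3 * k + 3 → table u v (m + k) i ≡ table u v k i
  table-+ zero    i≤ = refl
  table-+ (suc m) {k} i≤ = trans (table-suc (m + k) (ℕ.≤-trans i≤ 3k+3≤)) (table-+ m i≤)
    where
    3k+3≤ : 3 * k + 3 ≤ 3 * (m + k) + 3
    3k+3≤ = ℕ.+-monoˡ-≤ 3 (ℕ.*-monoʳ-≤ 3 (ℕ.m≤n+m k m))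

  table-diagonal : ∀ k {i} → i ≤ 3 * k + 3 → table u v i i ≡ table u v k i
  table-diagonal k {i} i≤ with ℕ.≤-total k i
  ... | inj₁ k≤i = subst (λ n → table u v n i ≡ table u v k i) (ℕ.m∸n+n≡m k≤i) (table-+ (i ∸ k) i≤)
  ... | inj₂ i≤k = subst (λ n → table u v i i ≡ table u v n i) (ℕ.m∸n+n≡m i≤k)
                         (sym (table-+ (k ∸ i) (ℕ.≤-trans (ℕ.m≤n*m i 3) (ℕ.m≤m+n (3 * i) 3))))

  α-diagonal : ∀ k {i} → i ≤ 3 * k + 3 → α u v i ≡ α[_] u v (table u v k) i
  α-diagonal k i≤ = cong proj₁ (table-diagonal k i≤)

  β-diagonal : ∀ k {i} → i ≤ 3 * k + 3 → β u v i ≡ β[_] u v (table u v k) i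
  β-diagonal k i≤ = cong proj₂ (table-diagonal k i≤)

  extend-3k+4 : ∀ f k → extend u v f k (3 * k + 4) ≡ (ι (- u) , b4[_,_] u v f k)
  extend-3k+4 f k with 3 * k + 4 ≟ 3 * k + 4
  ... | yes _ = refl
  ... | no ≢ = contradiction refl ≢

  extend-3k+5 : ∀ f k → extend u v f k (3 * k + 5) ≡ (a5[_,_] u v f k , b5[_,_] u v f k)
  extend-3k+5 f k with 3 * k + 5 ≟ 3 * k + 4 | 3 * k + 5 ≟ 3 * k + 5
  ... | yes 5≡4 | _ = contradiction (ℕ.+-cancelˡ-≡ (3 * k) _ _ 5≡4) λ ()
  ... | no _ | yes _ = refl
  ... | no _ | no ≢ = contradiction refl ≢

  extend-3k+6 : ∀ f k → extend u v f k (3 * k + 6) ≡ (a6[_,_] u v f k , b6[_,_] u v f k)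
  extend-3k+6 f k with 3 * k + 6 ≟ 3 * k + 4 | 3 * k + 6 ≟ 3 * k + 5 | 3 * k + 6 ≟ 3 * k + 6
  ... | yes 6≡4 | _ | _ = contradiction (ℕ.+-cancelˡ-≡ (3 * k) _ _ 6≡4) λ ()
  ... | no _ | yes 6≡5 | _ = contradiction (ℕ.+-cancelˡ-≡ (3 * k) _ _ 6≡5) λ ()
  ... | no _ | no _ | yes _ = refl
  ... | no _ | no _ | no ≢ = contradiction refl ≢

  private
    3k+m≤3[k+1]+3 : ∀ k {m} → m ≤ 6 → 3 * k + m ≤ 3 * suc k + 3
    3k+m≤3[k+1]+3 k {m} m≤6 = subst (3 * k + m ≤_) (3k+6≡3[k+1]+3 k) (ℕ.+-monoʳ-≤ (3 * k) m≤6)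

    k+2≤3k+3 : ∀ k → k + 2 ≤ 3 * k + 3
    k+2≤3k+3 k = ℕ.+-mono-≤ (ℕ.m≤n*m k 3) (ℕ.≤ᵇ⇒≤ 2 3 _)

    3k+2≤3k+3 : ∀ k → 3 * k + 2 ≤ 3 * k + 3
    3k+2≤3k+3 k = ℕ.+-monoʳ-≤ (3 * k) (ℕ.≤ᵇ⇒≤ 2 3 _)

  row-3k+4 : ∀ k → table u v (3 * k + 4) (3 * k + 4) ≡ (ι (- u) , b4[_,_] u v (table u v k) k)
  row-3k+4 k =
    trans (table-diagonal (suc k) (3k+m≤3[k+1]+3 k (ℕ.≤ᵇ⇒≤ 4 6 _))) (extend-3k+4 (table u v k) k)

  row-3k+5 : ∀ k → table u v (3 * k + 5) (3 * k + 5)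
                   ≡ (a5[_,_] u v (table u v k) k , b5[_,_] u v (table u v k) k)
  row-3k+5 k =
    trans (table-diagonal (suc k) (3k+m≤3[k+1]+3 k (ℕ.≤ᵇ⇒≤ 5 6 _))) (extend-3k+5 (table u v k) k)

  row-3k+6 : ∀ k → table u v (3 * k + 6) (3 * k + 6)
                   ≡ (a6[_,_] u v (table u v k) k , b6[_,_] u v (table u v k) k)
  row-3k+6 k =
    trans (table-diagonal (suc k) (3k+m≤3[k+1]+3 k ℕ.≤-refl)) (extend-3k+6 (table u v k) k)

  α-3k+4 : ∀ k → α u v (3 * k + 4) ≡ ι (- u)
  α-3k+4 k = cong proj₁ (row-3k+4 k)

  β-3k+4 : ∀ k → β u v (3 * k + 4) ≡ β u v (k + 2) ⊘ (β u v (3 * k + 3) ⊗ β u v (3 * k + 2))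
  β-3k+4 k = trans (cong proj₂ (row-3k+4 k))
    (cong₂ _⊘_ (sym (β-diagonal k (k+2≤3k+3 k)))
               (cong₂ _⊗_ (sym (β-diagonal k ℕ.≤-refl)) (sym (β-diagonal k (3k+2≤3k+3 k)))))

  β-3k+5 : ∀ k → β u v (3 * k + 5) ≡ U u v ⊗ U u v ⊖ V u v ⊖ β u v (3 * k + 4)
  β-3k+5 k = trans (cong proj₂ (row-3k+5 k))
                   (cong (U u v ⊗ U u v ⊖ V u v ⊖_) (sym (cong proj₂ (row-3k+4 k))))

  α-3k+5 : ∀ k → α u v (3 * k + 5)
                 ≡ U u v ⊖ (α u v (k + 2) ⊕ U u v ⊗ V u v ⊖ α u v (3 * k + 2) ⊗ β u v (3 * k + 4))
                           ⊘ β u v (3 * k + 5)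
  α-3k+5 k = trans (cong proj₁ (row-3k+5 k))
    (trans (cong₂ (λ A a → F A a (b4[_,_] u v (table u v k) k) (b5[_,_] u v (table u v k) k))
                  (sym (α-diagonal k (k+2≤3k+3 k))) (sym (α-diagonal k (3k+2≤3k+3 k))))
           (cong₂ (F (α u v (k + 2)) (α u v (3 * k + 2)))
                  (sym (cong proj₂ (row-3k+4 k))) (sym (cong proj₂ (row-3k+5 k)))))
    where
    F : M → M → M → M → M
    F A a b₄ b₅ = U u v ⊖ (A ⊕ U u v ⊗ V u v ⊖ a ⊗ b₄) ⊘ b₅

  α-3k+6 : ∀ k → α u v (3 * k + 6) ≡ U u v ⊖ α u v (3 * k + 5)
  α-3k+6 k = trans (cong proj₁ (row-3k+6 k)) (cong (U u v ⊖_) (sym (cong proj₁ (row-3k+5 k))))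

  β-3k+6 : ∀ k → β u v (3 * k + 6) ≡ V u v ⊖ α u v (3 * k + 5) ⊗ α u v (3 * k + 6)
  β-3k+6 k = trans (cong proj₂ (row-3k+6 k))
    (cong₂ (λ a₅ a₆ → V u v ⊖ a₅ ⊗ a₆) (sym (cong proj₁ (row-3k+5 k))) (sym (cong proj₁ (row-3k+6 k))))

-- Division by three

suc-divMod3 : ℕ × Fin 3 → ℕ × Fin 3
suc-divMod3 (q , zero)           = q , suc zero
suc-divMod3 (q , suc zero)       = q , suc (suc zero)
suc-divMod3 (q , suc (suc zero)) = suc q , zero

divMod3 : ℕ → ℕ × Fin 3
divMod3 zero    = 0 , zero
divMod3 (suc n) = suc-divMod3 (divMod3 n)

divMod3-3* : ∀ j → divMod3 (3 * j) ≡ (j , zero)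
divMod3-3* zero    = refl
divMod3-3* (suc j) = trans (cong divMod3 (ℕ.*-suc 3 j))
                           (cong (λ t → suc-divMod3 (suc-divMod3 (suc-divMod3 t))) (divMod3-3* j))

divMod3-3*+1 : ∀ j → divMod3 (3 * j + 1) ≡ (j , suc zero)
divMod3-3*+1 j = trans (cong divMod3 (ℕ.+-comm (3 * j) 1)) (cong suc-divMod3 (divMod3-3* j))

divMod3-3*+2 : ∀ j → divMod3 (3 * j + 2) ≡ (j , suc (suc zero))
divMod3-3*+2 j = trans (cong divMod3 (ℕ.+-comm (3 * j) 2))
                       (cong (λ t → suc-divMod3 (suc-divMod3 t)) (divMod3-3* j))

data Mod3 : ℕ → Set where
  [3*_]   : ∀ j → Mod3 (3 * j)
  [3*_+1] : ∀ j → Mod3 (3 * j + 1)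
  [3*_+2] : ∀ j → Mod3 (3 * j + 2)

mod3 : ∀ n → Mod3 n
mod3 zero = [3* 0 ]
mod3 (suc n) with mod3 n
... | [3* j ]   = subst Mod3 (ℕ.+-comm (3 * j) 1) [3* j +1]
... | [3* j +1] = subst Mod3 (ℕ.+-suc (3 * j) 1) [3* j +2]
... | [3* j +2] = subst Mod3 (trans (ℕ.*-suc 3 j) (cong suc (ℕ.+-comm 2 (3 * j)))) [3* suc j ]

-- Residues of α and β

module Sequence (p : ℕ) (p-prime : Prime p) (p≢2 : p ≢ 2) (u v : ℤ)
                (p∣u²-3 : + p ∣ u ℤ.* u ℤ.- + 3) (p∣v-1 : + p ∣ v ℤ.- + 1) where

  open Reduction p p-prime
  open Recurrence u v

  2-isUnit : IsUnit (+ 2)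
  2-isUnit p∣2 =
    p≢2 (ℕ.≤-antisym (ℕ.∣⇒≤ (∣⇒∣ᵤ p∣2)) (ℕ.nonTrivial⇒n>1 p {{prime⇒nonTrivial p-prime}}))

  U↦u : U u v ↦ u
  U↦u = ↦-ι u

  U²↦3 : U u v ⊗ U u v ↦ + 3
  U²↦3 = ↦-≈ (↦-⊗ U↦u U↦u) (p∣- p∣u²-3)

  V↦1 : V u v ↦ + 1
  V↦1 = ↦-≈ (↦-ι v) (p∣- p∣v-1)

  u·[_] : Bool → ℤ
  u·[ true ]  = u
  u·[ false ] = 0ℤ

  u-u·[b]≡u·[¬b] : ∀ b → u ℤ.- u·[ b ] ≡ u·[ not b ]
  u-u·[b]≡u·[¬b] true  = ℤ.+-inverseʳ u
  u-u·[b]≡u·[¬b] false = ℤ.+-identityʳ u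

  u·[b]+u·[¬b]≡u : ∀ b → u·[ b ] ℤ.+ u·[ not b ] ≡ u
  u·[b]+u·[¬b]≡u true  = ℤ.+-identityʳ u
  u·[b]+u·[¬b]≡u false = ℤ.+-identityˡ u

  u·[b]*u·[¬b]≡0 : ∀ b → u·[ b ] ℤ.* u·[ not b ] ≡ 0ℤ
  u·[b]*u·[¬b]≡0 true  = ℤ.*-zeroʳ u
  u·[b]*u·[¬b]≡0 false = refl

  1+δ₀ : ℕ → ℤ
  1+δ₀ zero    = + 2
  1+δ₀ (suc _) = + 1

  1+δ₀-isUnit : ∀ k → IsUnit (1+δ₀ k)
  1+δ₀-isUnit zero    = 2-isUnit
  1+δ₀-isUnit (suc _) = 1-isUnit

  1+δ₀-3* : ∀ j → 1+δ₀ (3 * j) ≡ 1+δ₀ j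
  1+δ₀-3* zero    = refl
  1+δ₀-3* (suc _) = refl

  1+δ₀-+suc : ∀ m n → 1+δ₀ (m + suc n) ≡ + 1
  1+δ₀-+suc m n = cong 1+δ₀ (ℕ.+-suc m n)

  reindexα : ∀ {i j a} → i ≡ j → α u v i ↦ a → α u v j ↦ a
  reindexα refl h = h

  reindexβ : ∀ {i j a} → i ≡ j → β u v i ↦ a → β u v j ↦ a
  reindexβ refl h = h

  -- Shape (divMod3 k) ε, with α_{3k+2} ↦ u·[ ε ], is the pattern α_{9j+2} ≡ u,
  -- α_{9j+5} ≡ α_{3j+3}, α_{9j+8} ≡ 0 at index k = 3j, 3j + 1, 3j + 2.
  Shape : ℕ × Fin 3 → Bool → Set
  Shape (j , zero)           ε = ε ≡ true
  Shape (j , suc zero)       ε = α u v (3 * j + 3) ↦ u·[ ε ]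
  Shape (j , suc (suc zero)) ε = ε ≡ false

  record Block (k : ℕ) : Set where
    field
      ε : Bool
      α₁ : α u v (3 * k + 1) ↦ - u
      β₁ : β u v (3 * k + 1) ↦ + 1
      α₂ : α u v (3 * k + 2) ↦ u·[ ε ]
      β₂ : β u v (3 * k + 2) ↦ 1+δ₀ k
      α₃ : α u v (3 * k + 3) ↦ u·[ not ε ]
      β₃ : β u v (3 * k + 3) ↦ + 1
      shape : Shape (divMod3 k) ε
  open Block

  α₂-with : ∀ {k b} (B : Block k) → ε B ≡ b → α u v (3 * k + 2) ↦ u·[ b ]
  α₂-with B refl = α₂ B

  ε-3* : ∀ j (B : Block (3 * j)) → ε B ≡ true
  ε-3* j B = subst (λ t → Shape t (ε B)) (divMod3-3* j) (shape B)

  α-3j+3↦u·[ε] : ∀ j (B : Block (3 * j + 1)) → α u v (3 * j + 3) ↦ u·[ ε B ]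
  α-3j+3↦u·[ε] j B = subst (λ t → Shape t (ε B)) (divMod3-3*+1 j) (shape B)

  ε-3*+2 : ∀ j (B : Block (3 * j + 2)) → ε B ≡ false
  ε-3*+2 j B = subst (λ t → Shape t (ε B)) (divMod3-3*+2 j) (shape B)

  block-0 : Block 0
  block-0 = record
    { ε = true
    ; α₁ = ↦-ι (- u)
    ; β₁ = ↦-ι (+ 1)
    ; α₂ = ↦-⊘ (↦-⊗ U↦u (↦-⊖ (↦-⊖ (↦-⊗ (↦-ι (+ 2)) V↦1) (↦-ι (+ 1))) U²↦3)) (↦-⊖ V↦1 U²↦3)
               (-‿isUnit 2-isUnit) (≡⇒≈ (ℤ.*-comm u _))
    ; β₂ = ↦-⊖ U²↦3 V↦1
    ; α₃ = ↦-⊘ (↦-⊗ (↦-ι (- u)) (↦-⊖ V↦1 (↦-ι (+ 1)))) (↦-⊖ V↦1 U²↦3)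
               (-‿isUnit 2-isUnit) (≡⇒≈ (ℤ.*-zeroʳ (- u)))
    ; β₃ = ↦-⊘ (↦-⊖ (↦-⊕ (↦-⊕ U²↦3 (↦-⊗ (↦-⊗ U²↦3 U↦u) U↦u)) (↦-⊗ (↦-⊗ V↦1 V↦1) V↦1))
                    (↦-⊗ (↦-⊗ (↦-⊗ (↦-ι (+ 3)) U↦u) U↦u) V↦1))
               (↦-⊗ (↦-⊖ V↦1 U²↦3) (↦-⊖ V↦1 U²↦3))
               (*-isUnit (-‿isUnit 2-isUnit) (-‿isUnit 2-isUnit)) (≡⇒≈ (solve (u ∷ [])))
    ; shape = refl
    }

  block-step : ∀ k {c A a} b →
    β u v (k + 2) ↦ c → β u v (3 * k + 2) ↦ c → IsUnit c → β u v (3 * k + 3) ↦ + 1 →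
    α u v (k + 2) ↦ A → α u v (3 * k + 2) ↦ a → a ℤ.- A ≈ u·[ b ] →
    Shape (suc-divMod3 (divMod3 k)) b → Block (suc k)
  block-step k {c} {A} {a} b βk+2↦c β3k+2↦c c-isUnit β3k+3↦1 αk+2↦A α3k+2↦a a-A≈u·[b] shape′ =
    record
      { ε = b
      ; α₁ = reindexα (3k+4≡3[k+1]+1 k) (subst (_↦ - u) (sym (α-3k+4 k)) (↦-ι (- u)))
      ; β₁ = reindexβ (3k+4≡3[k+1]+1 k) β3k+4↦1
      ; α₂ = reindexα (3k+5≡3[k+1]+2 k) α3k+5↦u·[b]
      ; β₂ = reindexβ (3k+5≡3[k+1]+2 k) β3k+5↦1
      ; α₃ = reindexα (3k+6≡3[k+1]+3 k) α3k+6↦u·[¬b]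
      ; β₃ = reindexβ (3k+6≡3[k+1]+3 k) β3k+6↦1
      ; shape = shape′
      }
    where
    β3k+4↦1 : β u v (3 * k + 4) ↦ + 1
    β3k+4↦1 = subst (_↦ + 1) (sym (β-3k+4 k))
      (↦-⊘ βk+2↦c (↦-⊗ β3k+3↦1 β3k+2↦c) (*-isUnit 1-isUnit c-isUnit) (≡⇒≈ (solve (c ∷ []))))

    β3k+5↦1 : β u v (3 * k + 5) ↦ + 1
    β3k+5↦1 = subst (_↦ + 1) (sym (β-3k+5 k)) (↦-⊖ (↦-⊖ U²↦3 V↦1) β3k+4↦1)

    α3k+5↦u·[b] : α u v (3 * k + 5) ↦ u·[ b ]
    α3k+5↦u·[b] = subst (_↦ u·[ b ]) (sym (α-3k+5 k))
      (↦-≈ (↦-⊖ U↦u (↦-⊘ numerator↦ β3k+5↦1 1-isUnit (≡⇒≈ (sym (ℤ.*-identityˡ numerator)))))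
           (≈-trans (≡⇒≈ u-numerator≡a-A) a-A≈u·[b]))
      where
      numerator : ℤ
      numerator = A ℤ.+ u ℤ.* + 1 ℤ.- a ℤ.* + 1
      numerator↦ : α u v (k + 2) ⊕ U u v ⊗ V u v ⊖ α u v (3 * k + 2) ⊗ β u v (3 * k + 4) ↦ numerator
      numerator↦ = ↦-⊖ (↦-⊕ αk+2↦A (↦-⊗ U↦u V↦1)) (↦-⊗ α3k+2↦a β3k+4↦1)
      u-numerator≡a-A : u ℤ.- (A ℤ.+ u ℤ.* + 1 ℤ.- a ℤ.* + 1) ≡ a ℤ.- A
      u-numerator≡a-A = solve (u ∷ A ∷ a ∷ [])

    α3k+6↦u·[¬b] : α u v (3 * k + 6) ↦ u·[ not b ]
    α3k+6↦u·[¬b] = subst (_↦ u·[ not b ]) (sym (α-3k+6 k))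
      (↦-≈ (↦-⊖ U↦u α3k+5↦u·[b]) (≡⇒≈ (u-u·[b]≡u·[¬b] b)))

    β3k+6↦1 : β u v (3 * k + 6) ↦ + 1
    β3k+6↦1 = subst (_↦ + 1) (sym (β-3k+6 k))
      (↦-≈ (↦-⊖ V↦1 (↦-⊗ α3k+5↦u·[b] α3k+6↦u·[¬b]))
           (≡⇒≈ (cong (λ x → + 1 ℤ.- x) (u·[b]*u·[¬b]≡0 b))))

  -- α_{k+2} and β_{k+2} lie in block j or j + 1, where k = 3j + r.
  block-next : ∀ k → (∀ {m} → m ≤ k → Block m) → Block (suc k)
  block-next k blocks≤ with mod3 k
  ... | [3* j ] =
    block-step (3 * j) (not (ε Bj))
      (↦-≈ (β₂ Bj) (≡⇒≈ (sym (1+δ₀-3* j)))) (β₂ Bk) (1+δ₀-isUnit (3 * j)) (β₃ Bk)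
      (α₂ Bj) (α₂-with Bk (ε-3* j Bk)) (≡⇒≈ (u-u·[b]≡u·[¬b] (ε Bj)))
      (subst (λ t → Shape (suc-divMod3 t) (not (ε Bj))) (sym (divMod3-3* j)) (α₃ Bj))
    where
    Bj : Block j
    Bj = blocks≤ (ℕ.m≤n*m j 3)
    Bk : Block (3 * j)
    Bk = blocks≤ ℕ.≤-refl
  ... | [3* j +1] =
    block-step (3 * j + 1) false
      (reindexβ (3j+3≡3j+1+2 j) (β₃ Bj)) (↦-≈ (β₂ Bk) (≡⇒≈ (1+δ₀-+suc (3 * j) 0)))
      1-isUnit (β₃ Bk)
      (reindexα (3j+3≡3j+1+2 j) (α-3j+3↦u·[ε] j Bk)) (α₂ Bk) (≡⇒≈ (ℤ.+-inverseʳ u·[ ε Bk ]))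
      (subst (λ t → Shape (suc-divMod3 t) false) (sym (divMod3-3*+1 j)) refl)
    where
    Bj : Block j
    Bj = blocks≤ (ℕ.≤-trans (ℕ.m≤n*m j 3) (ℕ.m≤m+n (3 * j) 1))
    Bk : Block (3 * j + 1)
    Bk = blocks≤ ℕ.≤-refl
    3j+3≡3j+1+2 : ∀ j → 3 * j + 3 ≡ 3 * j + 1 + 2
    3j+3≡3j+1+2 = ℕ-Solver.solve-∀
  ... | [3* j +2] =
    block-step (3 * j + 2) true
      (reindexβ (3[j+1]+1≡3j+2+2 j) (β₁ Bj+1)) (↦-≈ (β₂ Bk) (≡⇒≈ (1+δ₀-+suc (3 * j) 1)))
      1-isUnit (β₃ Bk)
      (reindexα (3[j+1]+1≡3j+2+2 j) (α₁ Bj+1)) (α₂-with Bk (ε-3*+2 j Bk)) (≡⇒≈ 0-[-u]≡u)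
      (subst (λ t → Shape (suc-divMod3 t) true) (sym (divMod3-3*+2 j)) refl)
    where
    Bj+1 : Block (suc j)
    Bj+1 = blocks≤ (subst (_≤ 3 * j + 2) (ℕ.+-comm j 1) (ℕ.+-mono-≤ (ℕ.m≤n*m j 3) (ℕ.≤ᵇ⇒≤ 1 2 _)))
    Bk : Block (3 * j + 2)
    Bk = blocks≤ ℕ.≤-refl
    3[j+1]+1≡3j+2+2 : ∀ j → 3 * suc j + 1 ≡ 3 * j + 2 + 2
    3[j+1]+1≡3j+2+2 = ℕ-Solver.solve-∀
    0-[-u]≡u : 0ℤ ℤ.- - u ≡ u
    0-[-u]≡u = trans (ℤ.+-identityˡ (- - u)) (ℤ.neg-involutive u)

  blocks : ∀ k → Block k
  blocks = <-rec Block λ where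
    zero    _   → block-0
    (suc k) rec → block-next k (λ m≤k → rec (s≤s m≤k))

  α-3k+2⊕α-3k+3↦u : ∀ k → α u v (3 * k + 2) ⊕ α u v (3 * k + 3) ↦ u
  α-3k+2⊕α-3k+3↦u k = ↦-≈ (↦-⊕ (α₂ B) (α₃ B)) (≡⇒≈ (u·[b]+u·[¬b]≡u (ε B)))
    where
    B : Block k
    B = blocks k

  α-9k+2↦u : ∀ k → α u v (9 * k + 2) ↦ u
  α-9k+2↦u k = reindexα (9k+2 k) (α₂-with B (ε-3* k B))
    where
    B : Block (3 * k)
    B = blocks (3 * k)
    9k+2 : ∀ k → 3 * (3 * k) + 2 ≡ 9 * k + 2
    9k+2 = ℕ-Solver.solve-∀

  α-9k+5≡α-3k+3 : ∀ k → α u v (9 * k + 5) ≡ α u v (3 * k + 3) [modℚ p ]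
  α-9k+5≡α-3k+3 k = ↦⇒≡[modℚ] (reindexα (9k+5 k) (α₂ B)) (α-3j+3↦u·[ε] k B)
    where
    B : Block (3 * k + 1)
    B = blocks (3 * k + 1)
    9k+5 : ∀ k → 3 * (3 * k + 1) + 2 ≡ 9 * k + 5
    9k+5 = ℕ-Solver.solve-∀

  α-9k+8↦0 : ∀ k → α u v (9 * k + 8) ↦ 0ℤ
  α-9k+8↦0 k = reindexα (9k+8 k) (α₂-with B (ε-3*+2 k B))
    where
    B : Block (3 * k + 2)
    B = blocks (3 * k + 2)
    9k+8 : ∀ k → 3 * (3 * k + 2) + 2 ≡ 9 * k + 8
    9k+8 = ℕ-Solver.solve-∀

  β-k+3↦1 : ∀ k → β u v (k + 3) ↦ + 1
  β-k+3↦1 k with mod3 k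
  ... | [3* j ]   = β₃ (blocks j)
  ... | [3* j +1] = reindexβ (3[j+1]+1 j) (β₁ (blocks (suc j)))
    where
    3[j+1]+1 : ∀ j → 3 * suc j + 1 ≡ 3 * j + 1 + 3
    3[j+1]+1 = ℕ-Solver.solve-∀
  ... | [3* j +2] = reindexβ (3[j+1]+2 j) (β₂ (blocks (suc j)))
    where
    3[j+1]+2 : ∀ j → 3 * suc j + 2 ≡ 3 * j + 2 + 3
    3[j+1]+2 = ℕ-Solver.solve-∀

lemma1 : (p : ℕ) → Prime p → p ≢ 2 → (u v : ℤ)
    → Data.Integer.Divisibility._∣_ (ℤ.+ p) (u ℤ.* u ℤ.- ℤ.+ 3)
    → Data.Integer.Divisibility._∣_ (ℤ.+ p) (v ℤ.- ℤ.+ 1)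
    → (k : ℕ)
    → (α u v (3 * k + 1) ≡ ι (ℤ.- u) [modℚ p ])
      × (α u v (3 * k + 2) ⊕ α u v (3 * k + 3) ≡ ι u [modℚ p ])
      × (α u v (9 * k + 2) ≡ ι u [modℚ p ])
      × (α u v (9 * k + 5) ≡ α u v (3 * k + 3) [modℚ p ])
      × (α u v (9 * k + 8) ≡ ι (ℤ.+ 0) [modℚ p ])
      × (β u v 1 ≡ ι (ℤ.+ 1) [modℚ p ])
      × (β u v 2 ≡ ι (ℤ.+ 2) [modℚ p ])
      × (β u v (k + 3) ≡ ι (ℤ.+ 1) [modℚ p ])
lemma1 p p-prime p≢2 u v p∣u²-3 p∣v-1 k =
    ↦⇒≡[modℚ] (Block.α₁ (blocks k)) (↦-ι (- u))
  , ↦⇒≡[modℚ] (α-3k+2⊕α-3k+3↦u k) (↦-ι u)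
  , ↦⇒≡[modℚ] (α-9k+2↦u k) (↦-ι u)
  , α-9k+5≡α-3k+3 k
  , ↦⇒≡[modℚ] (α-9k+8↦0 k) (↦-ι 0ℤ)
  , ↦⇒≡[modℚ] (Block.β₁ block-0) (↦-ι (+ 1))
  , ↦⇒≡[modℚ] (Block.β₂ block-0) (↦-ι (+ 2))
  , ↦⇒≡[modℚ] (β-k+3↦1 k) (↦-ι (+ 1))
  where
  open Reduction p p-prime
  open Sequence p p-prime p≢2 u v (∣ᵤ⇒∣ p∣u²-3) (∣ᵤ⇒∣ p∣v-1)
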